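{- Let $M$ be a matroid with set of circuits $\mathcal{C}(M)$ and set of cocircuits $\mathcal{C}^*(M)$. Introduce variables $a_{e,X}$ for each pair $X\in\mathcal{C}(M)$, $e\in X$, and $b_{e,Y}$ for each pair $Y\in\mathcal{C}^*(M)$, $e\in Y$, and let $R$ be the polynomial ring over $F_2$ in these variables. Consider the system of polynomial equations in $R$ consisting of: for every $X\in\mathcal{C}(M)$, $Y\in\mathcal{C}^*(M)$ with $X\cap Y=\{e,f\}$ (two distinct elements), $$a_{e,X}+b_{e,Y}+a_{f,X}+b_{f,Y}+1=0,$$ and for every $X\in\mathcal{C}(M)$, $Y\in\mathcal{C}^*(M)$ with $X\cap Y=\{e,f,g\}$ (three distinct elements), $$1+a_{e,X}+b_{e,Y}+a_{f,X}+b_{f,Y}+a_{g,X}+b_{g,Y}+a_{e,X}a_{f,X}+a_{e,X}a_{g,X}+a_{e,X}b_{f,Y}+a_{e,X}b_{g,Y}+a_{f,X}a_{g,X}$$ $$+a_{f,X}b_{e,Y}+a_{f,X}b_{g,Y}+a_{g,X}b_{e,Y}+a_{g,X}b_{f,Y}+b_{e,Y}b_{f,Y}+b_{e,Y}b_{g,Y}+b_{f,Y}b_{g,Y}=0.$$ Then $M$ is orientable if and only if this system has a solution over $F_2$.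
   Context: With $\Sigma=\{0,+,-\}$ (multiplied and compared with $0$ as signs), a $\Sigma$-mapping for a matroid $M$ is a pair of maps $\phi_\Sigma:E(M)\times\mathcal{C}(M)\to\Sigma$, $\phi^*_\Sigma:E(M)\times\mathcal{C}^*(M)\to\Sigma$ with $\phi_\Sigma(e,X)=0$ iff $e\notin X$ and $\phi^*_\Sigma(e,Y)=0$ iff $e\notin Y$. The matroid $M$ is orientable if it has a $\Sigma$-mapping such that for every $X\in\mathcal{C}(M)$, $Y\in\mathcal{C}^*(M)$ with $|X\cap Y|\in\{2,3\}$: $\phi_\Sigma(e,X)\phi^*_\Sigma(e,Y)>0$ for some $e\in X\cap Y$ if and only if $\phi_\Sigma(f,X)\phi^*_\Sigma(f,Y)<0$ for some $f\in X\cap Y$. -}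

module Defs where

open import Data.Nat using (ℕ)
open import Data.Bool using (Bool; true; false; _∧_; _xor_)
open import Data.Fin using (Fin)
open import Data.Fin.Subset using (Subset; ⊥; _∈_; _∉_; _⊆_; _⊂_; _∩_; _∪_; _-_; ∣_∣)
open import Data.Product using (Σ; ∃; _×_; _,_)
open import Data.Sum using (_⊎_)
open import Relation.Binary.PropositionalEquality using (_≡_; _≢_)
open import Relation.Nullary using (¬_; Dec)

-- Matroids on the finite ground set Fin n, given by their circuits
-- (standard circuit axioms C1–C3).  Being a circuit is decidable
-- (the set of circuits is a finite set).

record Matroid (n : ℕ) : Set₁ where
  field
    IsCircuit   : Subset n → Set
    circuit?    : (X : Subset n) → Dec (IsCircuit X)
    C1 : ¬ IsCircuit ⊥
    C2 : ∀ {X Y} → IsCircuit X → IsCircuit Y → X ⊆ Y → X ≡ Y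
    C3 : ∀ {X Y e} → IsCircuit X → IsCircuit Y → X ≢ Y → e ∈ X → e ∈ Y →
         ∃ λ Z → IsCircuit Z × Z ⊆ ((X ∪ Y) - e)

  Independent : Subset n → Set
  Independent I = ∀ X → IsCircuit X → ¬ (X ⊆ I)

  IsBasis : Subset n → Set
  IsBasis B = Independent B × (∀ I → Independent I → B ⊆ I → I ≡ B)

  -- cocircuits (circuits of the dual matroid M*): the minimal sets that
  -- meet every basis of M (equivalently, minimal sets not contained in
  -- any basis of M*, whose bases are the complements of bases of M)
  Meets : Subset n → Subset n → Set
  Meets Y B = ∃ λ e → e ∈ Y × e ∈ B

  MeetsAllBases : Subset n → Set
  MeetsAllBases Y = ∀ B → IsBasis B → Meets Y B

  IsCocircuit : Subset n → Set
  IsCocircuit Y = MeetsAllBases Y × (∀ Z → Z ⊂ Y → ¬ MeetsAllBases Z)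

data Sign : Set where
  zer pos neg : Sign

_·_ : Sign → Sign → Sign
zer · _   = zer
_   · zer = zer
pos · pos = pos
neg · neg = pos
pos · neg = neg
neg · pos = neg

module _ {n : ℕ} (M : Matroid n) where
  open Matroid M

  -- A Σ-mapping: φ(e,X) for circuits X, φ*(e,Y) for cocircuits Y
  -- (given as maps on all pairs; values on non-(co)circuits are irrelevant).
  IsΣMapping : (Fin n → Subset n → Sign) → (Fin n → Subset n → Sign) → Set
  IsΣMapping φ φ* =
    (∀ e X → IsCircuit X → (φ e X ≡ zer → e ∉ X) × (e ∉ X → φ e X ≡ zer)) ×
    (∀ e Y → IsCocircuit Y → (φ* e Y ≡ zer → e ∉ Y) × (e ∉ Y → φ* e Y ≡ zer))

  Orientable : Set
  Orientable = Σ (Fin n → Subset n → Sign) λ φ → Σ (Fin n → Subset n → Sign) λ φ* →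
    IsΣMapping φ φ* ×
    (∀ X Y → IsCircuit X → IsCocircuit Y → (∣ X ∩ Y ∣ ≡ 2 ⊎ ∣ X ∩ Y ∣ ≡ 3) →
      ((∃ λ e → e ∈ (X ∩ Y) × φ e X · φ* e Y ≡ pos) →
         (∃ λ f → f ∈ (X ∩ Y) × φ f X · φ* f Y ≡ neg)) ×
      ((∃ λ f → f ∈ (X ∩ Y) × φ f X · φ* f Y ≡ neg) →
         (∃ λ e → e ∈ (X ∩ Y) × φ e X · φ* e Y ≡ pos)))

  Inter2 : Subset n → Subset n → Fin n → Fin n → Set
  Inter2 X Y e f = e ≢ f × (∀ g → (g ∈ (X ∩ Y) → g ≡ e ⊎ g ≡ f) × (g ≡ e ⊎ g ≡ f → g ∈ (X ∩ Y)))

  Inter3 : Subset n → Subset n → Fin n → Fin n → Fin n → Set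
  Inter3 X Y e f g = e ≢ f × e ≢ g × f ≢ g ×
    (∀ h → (h ∈ (X ∩ Y) → h ≡ e ⊎ h ≡ f ⊎ h ≡ g) × (h ≡ e ⊎ h ≡ f ⊎ h ≡ g → h ∈ (X ∩ Y)))

  -- An F₂-point (Bool, + = xor, · = ∧): values a(e,X) of the variables
  -- a_{e,X} and b(e,Y) of the variables b_{e,Y}.  The polynomials of the
  -- system, evaluated at such a point:
  eq2 : (Fin n → Subset n → Bool) → (Fin n → Subset n → Bool) →
        Subset n → Subset n → Fin n → Fin n → Bool
  eq2 a b X Y e f = a e X xor b e Y xor a f X xor b f Y xor true

  eq3 : (Fin n → Subset n → Bool) → (Fin n → Subset n → Bool) →
        Subset n → Subset n → Fin n → Fin n → Fin n → Bool
  eq3 a b X Y e f g =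
    true xor ae xor be xor af xor bf xor ag xor bg
    xor (ae ∧ af) xor (ae ∧ ag) xor (ae ∧ bf) xor (ae ∧ bg) xor (af ∧ ag)
    xor (af ∧ be) xor (af ∧ bg) xor (ag ∧ be) xor (ag ∧ bf)
    xor (be ∧ bf) xor (be ∧ bg) xor (bf ∧ bg)
    where
      ae = a e X
      af = a f X
      ag = a g X
      be = b e Y
      bf = b f Y
      bg = b g Y

  SystemSolvable : Set
  SystemSolvable = Σ (Fin n → Subset n → Bool) λ a → Σ (Fin n → Subset n → Bool) λ b →
    (∀ X Y e f → IsCircuit X → IsCocircuit Y → Inter2 X Y e f → eq2 a b X Y e f ≡ false) ×
    (∀ X Y e f g → IsCircuit X → IsCocircuit Y → Inter3 X Y e f g → eq3 a b X Y e f g ≡ false)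

-- Identify the signs + and − with 0 and 1 in F₂, so that multiplying signs becomes adding.
-- Writing x_h = a_{h,X} + b_{h,Y}, the sign of φ(h,X)φ*(h,Y) is (−1)^{x_h}, and the two
-- polynomials of the system are 1 + x_e + x_f and 1 + e₁(x) + e₂(x), with e₁, e₂ the
-- elementary symmetric polynomials in x_e, x_f, x_g.  Over F₂ both vanish exactly when the
-- x_h are not all equal, that is, when both signs occur among the products on X ∩ Y, which
-- is what the orientability condition asks for.
module Submission where

open import Defs
open import Level using (0ℓ)
open import Data.Nat using (ℕ; suc)
open import Data.Bool using (Bool; true; false; _∧_; _xor_; if_then_else_)
open import Data.Bool.Properties using (xor-∧-commutativeRing)
open import Data.Fin using (Fin; zero; suc)
open import Data.Fin.Subset using (Subset; _∈_; _∉_; _∩_; _-_; ⁅_⁆; ∣_∣; inside; outside; Nonempty)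
open import Data.Fin.Subset.Properties
  using (_∈?_; x∈p∩q⁻; Empty-unique; ∣⊥∣≡0; p─⊥≡p; p─q⊆p; x∈p∧x≢y⇒x∈p-y)
open import Data.List using (List; []; _∷_; map; length; filter; allFin)
open import Data.List.Membership.Propositional using () renaming (_∈_ to _∈ˡ_)
open import Data.List.Membership.Propositional.Properties
  using (∈-map⁺; ∈-map⁻; ∈-filter⁺; ∈-filter⁻; ∈-allFin)
open import Data.List.Relation.Unary.All using (All; []; _∷_) renaming (lookup to All-lookup)
open import Data.List.Relation.Unary.AllPairs using ([]; _∷_)
open import Data.List.Relation.Unary.Any using (here; there)
open import Data.List.Relation.Unary.Unique.Propositional using (Unique)
open import Data.List.Relation.Unary.Unique.Propositional.Properties using (filter⁺; allFin⁺)
open import Data.Maybe using (nothing)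
open import Data.Product using (∃; ∃₂; _×_; _,_; proj₁; proj₂; uncurry)
open import Data.Product.Function.NonDependent.Propositional using (_×-⇔_)
open import Data.Sum using (_⊎_; inj₁; inj₂)
open import Data.Vec.Base using (_∷_; here; there)
open import Function using (_∘_)
open import Function.Bundles using (_⇔_; mk⇔; module Equivalence)
open import Function.Construct.Composition using (_⇔-∘_)
open import Function.Construct.Symmetry using (⇔-sym)
open import Relation.Binary.PropositionalEquality
  using (_≡_; _≢_; refl; sym; trans; cong; cong₂; subst; module ≡-Reasoning)
open import Relation.Nullary using (¬_; does; yes; no; contradiction)
open import Tactic.RingSolver using (solve-∀)
open import Tactic.RingSolver.Core.AlmostCommutativeRing
  using (AlmostCommutativeRing; fromCommutativeRing)

open Equivalence using (to; from)

private
  variable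
    n : ℕ
    A : Set

sign : Bool → Sign
sign false = pos
sign true  = neg

sign-xor : ∀ x y → sign x · sign y ≡ sign (x xor y)
sign-xor false false = refl
sign-xor false true  = refl
sign-xor true  false = refl
sign-xor true  true  = refl

sign-injective : ∀ {x y} → sign x ≡ sign y → x ≡ y
sign-injective {false} {false} _ = refl
sign-injective {true}  {true}  _ = refl
sign-injective {false} {true}  ()
sign-injective {true}  {false} ()

sign≢zer : ∀ x → sign x ≢ zer
sign≢zer false ()
sign≢zer true  ()

isNeg : Sign → Bool
isNeg neg = true
isNeg _   = false

sign-isNeg : ∀ {s} → s ≢ zer → sign (isNeg s) ≡ s
sign-isNeg {zer} s≢zer = contradiction refl s≢zer
sign-isNeg {pos} _     = refl
sign-isNeg {neg} _     = refl

∣p∣≡1+∣p-x∣ : ∀ {p : Subset n} {x} → x ∈ p → ∣ p ∣ ≡ suc ∣ p - x ∣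
∣p∣≡1+∣p-x∣ {p = inside  ∷ p} here        = cong (suc ∘ ∣_∣) (sym (p─⊥≡p p))
∣p∣≡1+∣p-x∣ {p = inside  ∷ p} (there x∈p) = cong suc (∣p∣≡1+∣p-x∣ x∈p)
∣p∣≡1+∣p-x∣ {p = outside ∷ p} (there x∈p) = ∣p∣≡1+∣p-x∣ x∈p

x∉p-x : ∀ {p : Subset n} {x} → x ∉ p - x
x∉p-x {p = _ ∷ _} {zero}  ()
x∉p-x {p = _ ∷ _} {suc x} (there x∈p-x) = x∉p-x x∈p-x

Enumerates : Subset n → List (Fin n) → Set
Enumerates S es = ∀ h → h ∈ S ⇔ h ∈ˡ es

elements : Subset n → List (Fin n)
elements {n} S = filter (_∈? S) (allFin n)

elements-unique : (S : Subset n) → Unique (elements S)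
elements-unique {n} S = filter⁺ (_∈? S) (allFin⁺ n)

elements-enumerates : (S : Subset n) → Enumerates S (elements S)
elements-enumerates S h =
  mk⇔ (∈-filter⁺ (_∈? S) (∈-allFin h)) (proj₂ ∘ ∈-filter⁻ (_∈? S) {xs = allFin _})

∣S∣≡length : ∀ {S : Subset n} {es} → Unique es → Enumerates S es → ∣ S ∣ ≡ length es
∣S∣≡length {n} {S} {[]} _ enum =
  trans (cong ∣_∣ (Empty-unique {p = S} λ (h , h∈S) → contradiction (to (enum h) h∈S) λ ()))
        (∣⊥∣≡0 n)
∣S∣≡length {S = S} {e ∷ es} (e∉es ∷ uniq) enum =
  trans (∣p∣≡1+∣p-x∣ (from (enum e) (here refl))) (cong suc (∣S∣≡length uniq enum-S-e))
  where
  enum-S-e : Enumerates (S - e) es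
  enum-S-e h = mk⇔ to′ from′
    where
    to′ : h ∈ S - e → h ∈ˡ es
    to′ h∈S-e with to (enum h) (p─q⊆p S ⁅ e ⁆ h∈S-e)
    ... | here refl  = contradiction h∈S-e x∉p-x
    ... | there h∈es = h∈es
    from′ : h ∈ˡ es → h ∈ S - e
    from′ h∈es = x∈p∧x≢y⇒x∈p-y (from (enum h) (there h∈es))
                               (λ h≡e → All-lookup e∉es h∈es (sym h≡e))

length-elements : (S : Subset n) → length (elements S) ≡ ∣ S ∣
length-elements S = sym (∣S∣≡length (elements-unique S) (elements-enumerates S))

Attains : (Fin n → A) → Subset n → A → Set
Attains f S v = ∃ λ h → h ∈ S × f h ≡ v

attains⇔∈map : ∀ {S : Subset n} {es} {x : Fin n → A} {v} →
               Enumerates S es → Attains x S v ⇔ v ∈ˡ map x es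
attains⇔∈map {x = x} enum = mk⇔
  (λ { (h , h∈S , refl) → ∈-map⁺ x (to (enum h) h∈S) })
  (λ v∈ → let (h , h∈es , v≡xh) = ∈-map⁻ x v∈ in h , from (enum h) h∈es , sym v≡xh)

Balanced : (Fin n → Sign) → Subset n → Set
Balanced p S = (Attains p S pos → Attains p S neg) × (Attains p S neg → Attains p S pos)

Mixed : List Bool → Set
Mixed bs = false ∈ˡ bs × true ∈ˡ bs

module _ {S : Subset n} {p : Fin n → Sign} {x : Fin n → Bool}
         (p≡sign∘x : ∀ {h} → h ∈ S → p h ≡ sign (x h)) where

  attains-sign : ∀ v → Attains x S v ⇔ Attains p S (sign v)
  attains-sign v = mk⇔
    (λ (h , h∈S , xh≡v) → h , h∈S , trans (p≡sign∘x h∈S) (cong sign xh≡v))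
    (λ (h , h∈S , ph≡sv) → h , h∈S , sign-injective (trans (sym (p≡sign∘x h∈S)) ph≡sv))

  balanced⇔attains-both : Nonempty S → Balanced p S ⇔ (Attains x S false × Attains x S true)
  balanced⇔attains-both (e , e∈S) = mk⇔ both balanced
    where
    both : Balanced p S → Attains x S false × Attains x S true
    both (pos→neg , neg→pos) with x e in xe
    ... | false = (e , e∈S , xe) ,
                  from (attains-sign true) (pos→neg (to (attains-sign false) (e , e∈S , xe)))
    ... | true  = from (attains-sign false) (neg→pos (to (attains-sign true) (e , e∈S , xe))) ,
                  (e , e∈S , xe)
    balanced : Attains x S false × Attains x S true → Balanced p S
    balanced (x-false , x-true) =
      (λ _ → to (attains-sign true) x-true) , (λ _ → to (attains-sign false) x-false)

  balanced⇔mixed : ∀ {e es} → Enumerates S (e ∷ es) → Balanced p S ⇔ Mixed (map x (e ∷ es))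
  balanced⇔mixed {e} enum =
    (attains⇔∈map enum ×-⇔ attains⇔∈map enum)
      ⇔-∘ balanced⇔attains-both (e , from (enum e) (here refl))

¬mixed-constant : ∀ {b bs} → All (_≡ b) bs → ¬ Mixed bs
¬mixed-constant all (false∈ , true∈) with All-lookup all false∈ | All-lookup all true∈
... | refl | ()

1+x+y≡0⇔mixed : ∀ x y → (x xor y xor true ≡ false) ⇔ Mixed (x ∷ y ∷ [])
1+x+y≡0⇔mixed x y = mk⇔ (to′ x y) (from′ x y)
  where
  to′ : ∀ x y → x xor y xor true ≡ false → Mixed (x ∷ y ∷ [])
  to′ false false ()
  to′ false true  _ = here refl , there (here refl)
  to′ true  false _ = there (here refl) , here refl
  to′ true  true  ()
  from′ : ∀ x y → Mixed (x ∷ y ∷ []) → x xor y xor true ≡ false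
  from′ false false m = contradiction m (¬mixed-constant (refl ∷ refl ∷ []))
  from′ false true  _ = refl
  from′ true  false _ = refl
  from′ true  true  m = contradiction m (¬mixed-constant (refl ∷ refl ∷ []))

1+e₁+e₂≡0⇔mixed : ∀ x y z →
  (true xor x xor y xor z xor (x ∧ y) xor (x ∧ z) xor (y ∧ z) ≡ false) ⇔ Mixed (x ∷ y ∷ z ∷ [])
1+e₁+e₂≡0⇔mixed x y z = mk⇔ (to′ x y z) (from′ x y z)
  where
  to′ : ∀ x y z → true xor x xor y xor z xor (x ∧ y) xor (x ∧ z) xor (y ∧ z) ≡ false →
        Mixed (x ∷ y ∷ z ∷ [])
  to′ false false false ()
  to′ false false true  _ = here refl , there (there (here refl))
  to′ false true  false _ = here refl , there (here refl)
  to′ false true  true  _ = here refl , there (here refl)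
  to′ true  false false _ = there (here refl) , here refl
  to′ true  false true  _ = there (here refl) , here refl
  to′ true  true  false _ = there (there (here refl)) , here refl
  to′ true  true  true  ()
  from′ : ∀ x y z → Mixed (x ∷ y ∷ z ∷ []) →
          true xor x xor y xor z xor (x ∧ y) xor (x ∧ z) xor (y ∧ z) ≡ false
  from′ false false false m = contradiction m (¬mixed-constant (refl ∷ refl ∷ refl ∷ []))
  from′ false false true  _ = refl
  from′ false true  false _ = refl
  from′ false true  true  _ = refl
  from′ true  false false _ = refl
  from′ true  false true  _ = refl
  from′ true  true  false _ = refl
  from′ true  true  true  m = contradiction m (¬mixed-constant (refl ∷ refl ∷ refl ∷ []))

F₂ : AlmostCommutativeRing 0ℓ 0ℓ
F₂ = fromCommutativeRing xor-∧-commutativeRing (λ _ → nothing)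

eq2-in-sums : ∀ ae be af bf →
  ae xor be xor af xor bf xor true ≡ (ae xor be) xor (af xor bf) xor true
eq2-in-sums = solve-∀ F₂

eq3-in-sums : ∀ ae be af bf ag bg →
    true xor ae xor be xor af xor bf xor ag xor bg
    xor (ae ∧ af) xor (ae ∧ ag) xor (ae ∧ bf) xor (ae ∧ bg) xor (af ∧ ag)
    xor (af ∧ be) xor (af ∧ bg) xor (ag ∧ be) xor (ag ∧ bf)
    xor (be ∧ bf) xor (be ∧ bg) xor (bf ∧ bg)
  ≡ true xor (ae xor be) xor (af xor bf) xor (ag xor bg)
    xor ((ae xor be) ∧ (af xor bf)) xor ((ae xor be) ∧ (ag xor bg)) xor ((af xor bf) ∧ (ag xor bg))
eq3-in-sums = solve-∀ F₂

∈-pair : ∀ {h e f : Fin n} → h ∈ˡ e ∷ f ∷ [] ⇔ (h ≡ e ⊎ h ≡ f)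
∈-pair = mk⇔ (λ { (here h≡e) → inj₁ h≡e ; (there (here h≡f)) → inj₂ h≡f })
             (λ { (inj₁ h≡e) → here h≡e ; (inj₂ h≡f) → there (here h≡f) })

∈-triple : ∀ {h e f g : Fin n} → h ∈ˡ e ∷ f ∷ g ∷ [] ⇔ (h ≡ e ⊎ h ≡ f ⊎ h ≡ g)
∈-triple = mk⇔
  (λ { (here h≡e) → inj₁ h≡e ; (there (here h≡f)) → inj₂ (inj₁ h≡f)
     ; (there (there (here h≡g))) → inj₂ (inj₂ h≡g) })
  (λ { (inj₁ h≡e) → here h≡e ; (inj₂ (inj₁ h≡f)) → there (here h≡f)
     ; (inj₂ (inj₂ h≡g)) → there (there (here h≡g)) })

signsOn : (Fin n → Subset n → Bool) → Fin n → Subset n → Sign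
signsOn c h X = if does (h ∈? X) then sign (c h X) else zer

signsOn-∈ : ∀ {c : Fin n → Subset n → Bool} {h X} → h ∈ X → signsOn c h X ≡ sign (c h X)
signsOn-∈ {h = h} {X} h∈X with h ∈? X
... | yes _   = refl
... | no h∉X = contradiction h∈X h∉X

signsOn-support : ∀ (c : Fin n → Subset n → Bool) h X →
  (signsOn c h X ≡ zer → h ∉ X) × (h ∉ X → signsOn c h X ≡ zer)
signsOn-support c h X with h ∈? X
... | yes h∈X = (λ s≡zer _ → sign≢zer (c h X) s≡zer) , (λ h∉X → contradiction h∈X h∉X)
... | no  h∉X = (λ _ → h∉X) , (λ _ → refl)

signBits : (Fin n → Subset n → Sign) → Fin n → Subset n → Bool
signBits φ h X = isNeg (φ h X)

module _ (M : Matroid n) where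
  open Matroid M

  signBit : (a b : Fin n → Subset n → Bool) → Subset n → Subset n → Fin n → Bool
  signBit a b X Y h = a h X xor b h Y

  Represents : (φ φ* : Fin n → Subset n → Sign) (a b : Fin n → Subset n → Bool) → Set
  Represents φ φ* a b = ∀ {X Y h} → IsCircuit X → IsCocircuit Y → h ∈ X ∩ Y →
                        φ h X · φ* h Y ≡ sign (signBit a b X Y h)

  signBits-represents : ∀ {φ φ*} → IsΣMapping M φ φ* →
                        Represents φ φ* (signBits φ) (signBits φ*)
  signBits-represents {φ} {φ*} (φ-support , φ*-support) {X} {Y} {h} cX cY h∈X∩Y = begin
    φ h X · φ* h Y
      ≡⟨ cong₂ _·_ (sym (sign-isNeg φ≢zer)) (sym (sign-isNeg φ*≢zer)) ⟩
    sign (signBits φ h X) · sign (signBits φ* h Y)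
      ≡⟨ sign-xor _ _ ⟩
    sign (signBit (signBits φ) (signBits φ*) X Y h) ∎
    where
    open ≡-Reasoning
    φ≢zer : φ h X ≢ zer
    φ≢zer φ≡zer = proj₁ (φ-support h X cX) φ≡zer (proj₁ (x∈p∩q⁻ X Y h∈X∩Y))
    φ*≢zer : φ* h Y ≢ zer
    φ*≢zer φ*≡zer = proj₁ (φ*-support h Y cY) φ*≡zer (proj₂ (x∈p∩q⁻ X Y h∈X∩Y))

  signsOn-isΣMapping : ∀ a b → IsΣMapping M (signsOn a) (signsOn b)
  signsOn-isΣMapping a b =
    (λ h X _ → signsOn-support a h X) , (λ h Y _ → signsOn-support b h Y)

  signsOn-represents : ∀ a b → Represents (signsOn a) (signsOn b) a b
  signsOn-represents a b {X} {Y} {h} _ _ h∈X∩Y =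
    trans (cong₂ _·_ (signsOn-∈ {c = a} h∈X) (signsOn-∈ {c = b} h∈Y)) (sign-xor (a h X) (b h Y))
    where
    h∈X : h ∈ X
    h∈X = proj₁ (x∈p∩q⁻ X Y h∈X∩Y)
    h∈Y : h ∈ Y
    h∈Y = proj₂ (x∈p∩q⁻ X Y h∈X∩Y)

  inter2⇔enumerated : ∀ {X Y e f} →
    Inter2 M X Y e f ⇔ (Unique (e ∷ f ∷ []) × Enumerates (X ∩ Y) (e ∷ f ∷ []))
  inter2⇔enumerated = mk⇔
    (λ (e≢f , spec) → ((e≢f ∷ []) ∷ [] ∷ []) ,
                      λ h → mk⇔ (from ∈-pair ∘ proj₁ (spec h)) (proj₂ (spec h) ∘ to ∈-pair))
    (λ { (((e≢f ∷ []) ∷ _) , enum) →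
         e≢f , λ h → (to ∈-pair ∘ to (enum h)) , (from (enum h) ∘ from ∈-pair) })

  inter3⇔enumerated : ∀ {X Y e f g} →
    Inter3 M X Y e f g ⇔ (Unique (e ∷ f ∷ g ∷ []) × Enumerates (X ∩ Y) (e ∷ f ∷ g ∷ []))
  inter3⇔enumerated = mk⇔
    (λ (e≢f , e≢g , f≢g , spec) → ((e≢f ∷ e≢g ∷ []) ∷ (f≢g ∷ []) ∷ [] ∷ []) ,
                      λ h → mk⇔ (from ∈-triple ∘ proj₁ (spec h)) (proj₂ (spec h) ∘ to ∈-triple))
    (λ { (((e≢f ∷ e≢g ∷ []) ∷ (f≢g ∷ []) ∷ _) , enum) →
         e≢f , e≢g , f≢g ,
         λ h → (to ∈-triple ∘ to (enum h)) , (from (enum h) ∘ from ∈-triple) })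

  inter2⇒∣∩∣≡2 : ∀ {X Y e f} → Inter2 M X Y e f → ∣ X ∩ Y ∣ ≡ 2
  inter2⇒∣∩∣≡2 = uncurry ∣S∣≡length ∘ to inter2⇔enumerated

  inter3⇒∣∩∣≡3 : ∀ {X Y e f g} → Inter3 M X Y e f g → ∣ X ∩ Y ∣ ≡ 3
  inter3⇒∣∩∣≡3 = uncurry ∣S∣≡length ∘ to inter3⇔enumerated

  ∣∩∣≡2⇒inter2 : ∀ {X Y} → ∣ X ∩ Y ∣ ≡ 2 → ∃₂ (Inter2 M X Y)
  ∣∩∣≡2⇒inter2 {X} {Y} ∣X∩Y∣≡2 =
    pair (elements (X ∩ Y)) (elements-unique _) (elements-enumerates _)
         (trans (length-elements (X ∩ Y)) ∣X∩Y∣≡2)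
    where
    pair : ∀ es → Unique es → Enumerates (X ∩ Y) es → length es ≡ 2 → ∃₂ (Inter2 M X Y)
    pair (e ∷ f ∷ [])    uniq enum _ = e , f , from inter2⇔enumerated (uniq , enum)
    pair []              _    _    ()
    pair (_ ∷ [])        _    _    ()
    pair (_ ∷ _ ∷ _ ∷ _) _    _    ()

  ∣∩∣≡3⇒inter3 : ∀ {X Y} → ∣ X ∩ Y ∣ ≡ 3 → ∃ λ e → ∃₂ (Inter3 M X Y e)
  ∣∩∣≡3⇒inter3 {X} {Y} ∣X∩Y∣≡3 =
    triple (elements (X ∩ Y)) (elements-unique _) (elements-enumerates _)
           (trans (length-elements (X ∩ Y)) ∣X∩Y∣≡3)
    where
    triple : ∀ es → Unique es → Enumerates (X ∩ Y) es → length es ≡ 3 →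
             ∃ λ e → ∃₂ (Inter3 M X Y e)
    triple (e ∷ f ∷ g ∷ [])    uniq enum _ = e , f , g , from inter3⇔enumerated (uniq , enum)
    triple []                  _    _    ()
    triple (_ ∷ [])            _    _    ()
    triple (_ ∷ _ ∷ [])        _    _    ()
    triple (_ ∷ _ ∷ _ ∷ _ ∷ _) _    _    ()

  module _ {φ φ* a b} (rep : Represents φ φ* a b)
           {X Y} (cX : IsCircuit X) (cY : IsCocircuit Y) where

    balanced⇔eq2 : ∀ {e f} → Inter2 M X Y e f →
      Balanced (λ h → φ h X · φ* h Y) (X ∩ Y) ⇔ (eq2 M a b X Y e f ≡ false)
    balanced⇔eq2 {e} {f} inter =
      subst (λ t → Balanced _ _ ⇔ (t ≡ false))
            (sym (eq2-in-sums (a e X) (b e Y) (a f X) (b f Y)))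
            (⇔-sym (1+x+y≡0⇔mixed _ _)
              ⇔-∘ balanced⇔mixed (rep cX cY) (proj₂ (to inter2⇔enumerated inter)))

    balanced⇔eq3 : ∀ {e f g} → Inter3 M X Y e f g →
      Balanced (λ h → φ h X · φ* h Y) (X ∩ Y) ⇔ (eq3 M a b X Y e f g ≡ false)
    balanced⇔eq3 {e} {f} {g} inter =
      subst (λ t → Balanced _ _ ⇔ (t ≡ false))
            (sym (eq3-in-sums (a e X) (b e Y) (a f X) (b f Y) (a g X) (b g Y)))
            (⇔-sym (1+e₁+e₂≡0⇔mixed _ _ _)
              ⇔-∘ balanced⇔mixed (rep cX cY) (proj₂ (to inter3⇔enumerated inter)))

  orientable⇒solvable : Orientable M → SystemSolvable M
  orientable⇒solvable (φ , φ* , isΣ , oriented) = a , b , eq2-vanishes , eq3-vanishes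
    where
    a b : Fin n → Subset n → Bool
    a = signBits φ
    b = signBits φ*
    rep : Represents φ φ* a b
    rep = signBits-represents isΣ
    eq2-vanishes : ∀ X Y e f → IsCircuit X → IsCocircuit Y → Inter2 M X Y e f →
                   eq2 M a b X Y e f ≡ false
    eq2-vanishes X Y e f cX cY inter = to (balanced⇔eq2 {a = a} {b} rep cX cY inter)
                                          (oriented X Y cX cY (inj₁ (inter2⇒∣∩∣≡2 inter)))
    eq3-vanishes : ∀ X Y e f g → IsCircuit X → IsCocircuit Y → Inter3 M X Y e f g →
                   eq3 M a b X Y e f g ≡ false
    eq3-vanishes X Y e f g cX cY inter = to (balanced⇔eq3 {a = a} {b} rep cX cY inter)
                                            (oriented X Y cX cY (inj₂ (inter3⇒∣∩∣≡3 inter)))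

  solvable⇒orientable : SystemSolvable M → Orientable M
  solvable⇒orientable (a , b , eq2-vanishes , eq3-vanishes) =
    signsOn a , signsOn b , signsOn-isΣMapping a b , oriented
    where
    rep : Represents (signsOn a) (signsOn b) a b
    rep = signsOn-represents a b
    oriented : ∀ X Y → IsCircuit X → IsCocircuit Y → ∣ X ∩ Y ∣ ≡ 2 ⊎ ∣ X ∩ Y ∣ ≡ 3 →
               Balanced (λ h → signsOn a h X · signsOn b h Y) (X ∩ Y)
    oriented X Y cX cY (inj₁ ∣X∩Y∣≡2) with ∣∩∣≡2⇒inter2 ∣X∩Y∣≡2
    ... | e , f , inter =
      from (balanced⇔eq2 {a = a} {b} rep cX cY inter) (eq2-vanishes X Y e f cX cY inter)
    oriented X Y cX cY (inj₂ ∣X∩Y∣≡3) with ∣∩∣≡3⇒inter3 ∣X∩Y∣≡3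
    ... | e , f , g , inter =
      from (balanced⇔eq3 {a = a} {b} rep cX cY inter) (eq3-vanishes X Y e f g cX cY inter)

theorem3p2 : (n : ℕ) (M : Matroid n) →
    (Orientable M → SystemSolvable M) × (SystemSolvable M → Orientable M)
theorem3p2 n M = orientable⇒solvable M , solvable⇒orientable M
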